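{- Let $G$ be a Nim sequence with seed of length $L$ over a sequence $(\mathcal{Y}_x)_{x\in\mathbb{N}}$ of finite subsets of $\mathbb{Z}$ that is additively periodic with period length $p$, and let $R\in\mathbb{N}^+$. Then $G$ is additively periodic with a period length dividing $Rp$ if and only if there exists $x\ge L$ such that $T_{x+Rp}=T_x+Rp$ and $T^*_{x+Rp}=T^*_x+Rp$.
   Context: $\mathbb{N}=\{0,1,2,\dots\}$. For a finite $Y\subseteq\mathbb{Z}$, $\operatorname{mex}(Y)=\min(\mathbb{N}\setminus Y)$. $(\mathcal{Y}_x)$ is additively periodic with period length $p\ge1$ if $\mathcal{Y}_{x+p}=\mathcal{Y}_x+p$ for all $x\in\mathbb{N}$ ($p$ least such). A Nim sequence over $(\mathcal{Y}_x)$ with seed $[g_0,\dots,g_{L-1}]$ ($g_i\in\mathbb{N}$ pairwise distinct) is $G:\mathbb{N}\to\mathbb{N}$ with $G(x)=g_x$ for $x<L$ and $G(x)=\operatorname{mex}(\{G(x'):x'<x\}\cup\mathcal{Y}_x)$ for $x\ge L$. $G$ is additively periodic if there are $\tilde P$, $\tilde p\ge1$ with $G(x+\tilde p)=G(x)+\tilde p$ for all $x\ge\tilde P$; the least such $\tilde p$ is the period length. The cut after $x\in\mathbb{N}$: $S_x=\{x'\in\mathbb{N}:x'\le x,\ G(x')>x\}$, $T_x=\{x'\in\mathbb{N}:x'>x,\ G(x')\le x\}$, and $S^*_x=G(T_x)$, $T^*_x=G(S_x)$. -}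

module Defs where

open import Data.Nat using (ℕ; zero; suc; _+_; _*_; _≤_; _<_; _≥_)
open import Data.Integer as ℤ using (ℤ; +_)
open import Data.List using (List; length; lookup)
open import Data.List.Membership.Propositional using (_∈_)
open import Data.List.Relation.Unary.Unique.Propositional using (Unique)
open import Data.Fin using (fromℕ<)
open import Data.Product using (Σ; ∃; _×_)
open import Data.Sum using (_⊎_)
open import Relation.Binary.PropositionalEquality using (_≡_)
open import Relation.Nullary using (¬_)
open import Function.Bundles using (_⇔_)

-- A sequence (𝒴_x) of finite subsets of ℤ, each given by a list of its elements
-- (membership is list membership; order/duplicates are irrelevant).
FinSubsetSeq : Set
FinSubsetSeq = ℕ → List ℤ

YShift : FinSubsetSeq → ℕ → Set
YShift Y p = ∀ x z → (z ∈ Y (x + p)) ⇔ (∃ λ w → w ∈ Y x × z ≡ w ℤ.+ + p)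

YPeriodLength : FinSubsetSeq → ℕ → Set
YPeriodLength Y p = 1 ≤ p × YShift Y p × (∀ q → 1 ≤ q → q < p → ¬ YShift Y q)

IsMex : (ℤ → Set) → ℕ → Set
IsMex S m = ¬ S (+ m) × (∀ k → k < m → S (+ k))

MexSet : FinSubsetSeq → (ℕ → ℕ) → ℕ → ℤ → Set
MexSet Y G x z = (∃ λ x' → x' < x × + G x' ≡ z) ⊎ (z ∈ Y x)

IsNimSeq : FinSubsetSeq → List ℕ → (ℕ → ℕ) → Set
IsNimSeq Y seed G =
  Unique seed
  × (∀ x (h : x < length seed) → G x ≡ lookup seed (fromℕ< h))
  × (∀ x → length seed ≤ x → IsMex (MexSet Y G x) (G x))

GShift : (ℕ → ℕ) → ℕ → Set
GShift G q = ∃ λ P → ∀ x → P ≤ x → G (x + q) ≡ G x + q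

GPeriodLength : (ℕ → ℕ) → ℕ → Set
GPeriodLength G q = 1 ≤ q × GShift G q × (∀ q' → 1 ≤ q' → q' < q → ¬ GShift G q')

T : (ℕ → ℕ) → ℕ → ℕ → Set
T G x x' = x < x' × G x' ≤ x

S : (ℕ → ℕ) → ℕ → ℕ → Set
S G x x' = x' ≤ x × x < G x'

T* : (ℕ → ℕ) → ℕ → ℕ → Set
T* G x v = ∃ λ x' → S G x x' × G x' ≡ v

_≐_+ˢ_ : (ℕ → Set) → (ℕ → Set) → ℕ → Set
A ≐ B +ˢ k = ∀ y → A y ⇔ (∃ λ y' → B y' × y ≡ y' + k)

-- If G (y + N) = G y + N for all y ≥ P, then every cut after an x ≥ P that lies above all
-- values G y, y < P + N, is shifted by N.
-- Conversely, let the cut after x ≥ L be shifted by N = R p. For y > x with G y > x, the numbers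
-- G (y + N) and G y + N are the mexes of two sets that correspond to each other above the cut
-- under v ↦ v + N: the 𝒴-parts because 𝒴 is N-periodic, earlier values at positions ≤ x via
-- T*, those at later positions by induction on y, and the T-condition keeps G (y + N) above the
-- cut. Since G is injective and 𝒴 has no small elements far out, G y > x eventually, so G is
-- additively periodic with shift N. Once one shift is known the others are decidable by a finite
-- check, so a least period exists, and it divides every shift.
module Submission where

open import Defs
open import Data.Nat using (ℕ; zero; suc; _+_; _*_; _≤_; _<_; _≥_; _∸_; _⊔_; z≤n; s≤s; NonZero; >-nonZero; _%_; _/_)
open import Data.Nat.Properties
open import Data.Nat.Divisibility using (_∣_; divides; m%n≡0⇒n∣m)
open import Data.Nat.DivMod using (m≡m%n+[m/n]*n; m%n<n)
open import Data.Nat.Induction using (<-rec)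
open import Data.Integer as ℤ using (ℤ; +_; ∣_∣)
import Data.Integer.Properties as ℤP
open import Data.List using (List; []; _∷_; length)
open import Data.List.Membership.Propositional using (_∈_; _∉_)
open import Data.List.Relation.Unary.Any using (here; there)
open import Data.Fin using (toℕ; fromℕ<)
import Data.Fin.Properties as FinP
open import Data.Product using (∃; ∃₂; _×_; _,_; proj₁; proj₂)
open import Data.Sum using (inj₁; inj₂)
open import Data.Empty using (⊥-elim)
open import Relation.Nullary using (¬_; Dec; yes; no)
open import Relation.Nullary.Decidable using (map′)
open import Relation.Unary using (Decidable)
open import Relation.Binary.PropositionalEquality
open import Relation.Binary.Definitions using (tri<; tri≈; tri>)
open import Function.Bundles using (_⇔_; mk⇔; Equivalence)
open import Algebra.Properties.AbelianGroup ℤP.+-0-abelianGroup using (∙-cancelʳ; xyx⁻¹≈y)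
open import Algebra.Properties.CommutativeSemigroup +-commutativeSemigroup using (xy∙z≈xz∙y)

+v≡w+m⇒m≤v+∣w∣ : ∀ {v m} w → + v ≡ w ℤ.+ + m → m ≤ v + ∣ w ∣
+v≡w+m⇒m≤v+∣w∣ {v} {m} w eq = begin
  m                            ≡⟨ cong ∣_∣ (sym (xyx⁻¹≈y w (+ m))) ⟩
  ∣ w ℤ.+ + m ℤ.+ ℤ.- w ∣      ≤⟨ ℤP.∣i+j∣≤∣i∣+∣j∣ (w ℤ.+ + m) (ℤ.- w) ⟩
  ∣ w ℤ.+ + m ∣ + ∣ ℤ.- w ∣    ≡⟨ cong₂ _+_ (cong ∣_∣ (sym eq)) (ℤP.∣-i∣≡∣i∣ w) ⟩
  v + ∣ w ∣                    ∎
  where open ≤-Reasoning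

≤-+-split : ∀ {a y} N → a + N ≤ y → ∃ λ y' → a ≤ y' × y ≡ y' + N
≤-+-split {a} {y} N a+N≤y =
  y ∸ N , subst (_≤ y ∸ N) (m+n∸n≡m a N) (∸-monoˡ-≤ N a+N≤y) ,
  sym (m∸n+n≡m (≤-trans (m≤n+m N a) a+N≤y))

bounded-below : (f : ℕ → ℕ) (n : ℕ) → ∃ λ b → ∀ {m} → m < n → f m ≤ b
bounded-below f zero = 0 , λ ()
bounded-below f (suc n) with bounded-below f n
... | b , bound = f n ⊔ b , below
  where
  below : ∀ {m} → m < suc n → f m ≤ f n ⊔ b
  below m<1+n with m<1+n⇒m<n∨m≡n m<1+n
  ... | inj₁ m<n  = ≤-trans (bound m<n) (m≤n⊔m (f n) b)
  ... | inj₂ refl = m≤m⊔n (f n) b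

∣∣-bounded : (ws : List ℤ) → ∃ λ b → ∀ {w} → w ∈ ws → ∣ w ∣ ≤ b
∣∣-bounded [] = 0 , λ ()
∣∣-bounded (w ∷ ws) with ∣∣-bounded ws
... | b , bound = ∣ w ∣ ⊔ b , λ where
  (here refl) → m≤m⊔n ∣ w ∣ b
  (there w'∈) → ≤-trans (bound w'∈) (m≤n⊔m ∣ w ∣ b)

pigeonhole : ∀ n (f : ℕ → ℕ) → (∀ {i} → i ≤ n → f i < n) →
             ∃₂ λ i j → i < j × j ≤ n × f i ≡ f j
pigeonhole n f f<n with FinP.pigeonhole (n<1+n n) (λ i → fromℕ< (f<n (FinP.toℕ≤pred[n] i)))
... | i , j , i<j , eq =
  toℕ i , toℕ j , i<j , FinP.toℕ≤pred[n] j , FinP.fromℕ<-injective _ _ _ _ eq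

least-witness : ∀ {P : ℕ → Set} → Decidable P → ∀ {n} → P n →
                ∃ λ m → P m × (∀ {k} → k < m → ¬ P k)
least-witness {P} P? {n} = <-rec (λ n → P n → Least) search n
  where
  Least : Set
  Least = ∃ λ m → P m × (∀ {k} → k < m → ¬ P k)
  search : ∀ n → (∀ {m} → m < n → P m → Least) → P n → Least
  search n rec Pn with anyUpTo? P? n
  ... | yes (m , m<n , Pm) = rec m<n Pm
  ... | no none            = n , Pn , λ k<n Pk → none (_ , k<n , Pk)

ShiftsFrom : (ℕ → ℕ) → ℕ → ℕ → Set
ShiftsFrom G P q = ∀ x → P ≤ x → G (x + q) ≡ G x + q

module _ {G : ℕ → ℕ} where

  shiftsFrom-* : ∀ {P a} → ShiftsFrom G P a → ∀ k → ShiftsFrom G P (k * a)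
  shiftsFrom-* h zero x _ = trans (cong G (+-identityʳ x)) (sym (+-identityʳ (G x)))
  shiftsFrom-* {P} {a} h (suc k) x P≤x = begin
    G (x + (a + k * a))  ≡⟨ cong G (sym (+-assoc x a (k * a))) ⟩
    G (x + a + k * a)    ≡⟨ shiftsFrom-* h k (x + a) (≤-trans P≤x (m≤m+n x a)) ⟩
    G (x + a) + k * a    ≡⟨ cong (_+ k * a) (h x P≤x) ⟩
    G x + a + k * a      ≡⟨ +-assoc (G x) a (k * a) ⟩
    G x + (a + k * a)    ∎
    where open ≡-Reasoning

  GShift-* : ∀ {a} → GShift G a → ∀ k → GShift G (k * a)
  GShift-* (P , h) k = P , shiftsFrom-* h k

  GShift-cancelˡ : ∀ {a b} → GShift G a → GShift G (a + b) → GShift G b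
  GShift-cancelˡ {a} {b} (P₁ , h₁) (P₂ , h₂) = P₁ + P₂ , λ x P₁+P₂≤x →
    +-cancelʳ-≡ a _ _ (begin
      G (x + b) + a    ≡⟨ h₁ (x + b) (≤-trans (m≤m+n P₁ P₂) (≤-trans P₁+P₂≤x (m≤m+n x b))) ⟨
      G (x + b + a)    ≡⟨ cong G (trans (+-assoc x b a) (cong (λ t → x + t) (+-comm b a))) ⟩
      G (x + (a + b))  ≡⟨ h₂ x (≤-trans (m≤n+m P₂ P₁) P₁+P₂≤x) ⟩
      G x + (a + b)    ≡⟨ cong (λ t → G x + t) (+-comm a b) ⟩
      G x + (b + a)    ≡⟨ +-assoc (G x) b a ⟨
      G x + b + a      ∎)
    where open ≡-Reasoning

  shiftsFrom-lower : ∀ {P N q} .{{_ : NonZero N}} → ShiftsFrom G P N → GShift G q → ShiftsFrom G P q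
  shiftsFrom-lower {P} {N} {q} hN (P₁ , hq) x P≤x = +-cancelʳ-≡ K _ _ (begin
    G (x + q) + K    ≡⟨ hK (x + q) (≤-trans P≤x (m≤m+n x q)) ⟨
    G (x + q + K)    ≡⟨ cong G (xy∙z≈xz∙y x q K) ⟩
    G (x + K + q)    ≡⟨ hq (x + K) (≤-trans (m≤m*n P₁ N) (m≤n+m K x)) ⟩
    G (x + K) + q    ≡⟨ cong (_+ q) (hK x P≤x) ⟩
    G x + K + q      ≡⟨ xy∙z≈xz∙y (G x) K q ⟩
    G x + q + K      ∎)
    where
    open ≡-Reasoning
    K = P₁ * N
    hK : ShiftsFrom G P K
    hK = shiftsFrom-* hN P₁

  shiftsFrom-window : ∀ {P N q} .{{_ : NonZero N}} → ShiftsFrom G P N →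
                      (∀ {i} → i < N → G (P + i + q) ≡ G (P + i) + q) → ShiftsFrom G P q
  shiftsFrom-window {P} {N} {q} hN window x P≤x = begin
    G (x + q)              ≡⟨ cong (λ z → G (z + q)) x≡y+kN ⟩
    G (y + k * N + q)      ≡⟨ cong G (xy∙z≈xz∙y y (k * N) q) ⟩
    G (y + q + k * N)      ≡⟨ shiftsFrom-* hN k (y + q) (≤-trans (m≤m+n P i) (m≤m+n y q)) ⟩
    G (y + q) + k * N      ≡⟨ cong (_+ k * N) (window (m%n<n d N)) ⟩
    G y + q + k * N        ≡⟨ xy∙z≈xz∙y (G y) q (k * N) ⟩
    G y + k * N + q        ≡⟨ cong (_+ q) (shiftsFrom-* hN k y (m≤m+n P i)) ⟨
    G (y + k * N) + q      ≡⟨ cong (λ z → G z + q) x≡y+kN ⟨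
    G x + q                ∎
    where
    open ≡-Reasoning
    d = x ∸ P
    i = d % N
    k = d / N
    y = P + i
    x≡y+kN : x ≡ y + k * N
    x≡y+kN = begin
      x              ≡⟨ m+[n∸m]≡n P≤x ⟨
      P + d          ≡⟨ cong (λ t → P + t) (m≡m%n+[m/n]*n d N) ⟩
      P + (i + k * N) ≡⟨ +-assoc P i (k * N) ⟨
      y + k * N      ∎

  GShift? : ∀ {P N} .{{_ : NonZero N}} → ShiftsFrom G P N → ∀ q → Dec (GShift G q)
  GShift? {P} {N} hN q =
    map′ sufficient necessary (allUpTo? (λ i → G (P + i + q) ≟ G (P + i) + q) N)
    where
    sufficient : (∀ {i} → i < N → G (P + i + q) ≡ G (P + i) + q) → GShift G q
    sufficient window = P , shiftsFrom-window hN window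
    necessary : GShift G q → ∀ {i} → i < N → G (P + i + q) ≡ G (P + i) + q
    necessary shift {i} _ = shiftsFrom-lower hN shift (P + i) (m≤m+n P i)

  GShift⇒GPeriodLength : ∀ {N} → 1 ≤ N → GShift G N → ∃ (GPeriodLength G)
  GShift⇒GPeriodLength {suc _} _ (P , hN) with least-witness (λ k → GShift? hN (suc k)) (P , hN)
  ... | m , shift , minimal = suc m , s≤s z≤n , shift , not-shift
    where
    not-shift : ∀ q → 1 ≤ q → q < suc m → ¬ GShift G q
    not-shift (suc k) _ (s≤s k<m) = minimal k<m

  GPeriodLength∣GShift : ∀ {q n} → GPeriodLength G q → GShift G n → q ∣ n
  GPeriodLength∣GShift {q} {n} (1≤q , shift-q , minimal) shift-n = m%n≡0⇒n∣m n q n%q≡0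
    where
    instance
      q-nonZero : NonZero q
      q-nonZero = >-nonZero 1≤q
    shift-n%q : GShift G (n % q)
    shift-n%q = GShift-cancelˡ (GShift-* shift-q (n / q))
      (subst (GShift G) (trans (m≡m%n+[m/n]*n n q) (+-comm (n % q) _)) shift-n)
    n%q≡0 : n % q ≡ 0
    n%q≡0 with n % q in eq
    ... | zero  = refl
    ... | suc r = ⊥-elim (minimal (suc r) (s≤s z≤n) (subst (_< q) eq (m%n<n n q))
                                  (subst (GShift G) eq shift-n%q))

module _ {Y : FinSubsetSeq} where

  YShift-zero : YShift Y 0
  YShift-zero x z = mk⇔
    (λ z∈ → z , subst (λ y → z ∈ Y y) (+-identityʳ x) z∈ , sym (ℤP.+-identityʳ z))
    (λ { (w , w∈ , refl) →
           subst₂ (λ u y → u ∈ Y y) (sym (ℤP.+-identityʳ w)) (sym (+-identityʳ x)) w∈ })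

  YShift-+ : ∀ {a b} → YShift Y a → YShift Y b → YShift Y (a + b)
  YShift-+ {a} {b} shift-a shift-b x z = mk⇔ down up
    where
    reassoc : ∀ w → w ℤ.+ + a ℤ.+ + b ≡ w ℤ.+ + (a + b)
    reassoc w = trans (ℤP.+-assoc w (+ a) (+ b)) (cong (λ t → w ℤ.+ t) (sym (ℤP.pos-+ a b)))
    down : z ∈ Y (x + (a + b)) → ∃ λ w → w ∈ Y x × z ≡ w ℤ.+ + (a + b)
    down z∈ with Equivalence.to (shift-b (x + a) z) (subst (λ y → z ∈ Y y) (sym (+-assoc x a b)) z∈)
    ... | u , u∈ , refl with Equivalence.to (shift-a x u) u∈
    ...   | w , w∈ , refl = w , w∈ , reassoc w
    up : (∃ λ w → w ∈ Y x × z ≡ w ℤ.+ + (a + b)) → z ∈ Y (x + (a + b))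
    up (w , w∈ , refl) = subst₂ (λ u y → u ∈ Y y) (reassoc w) (+-assoc x a b)
      (Equivalence.from (shift-b (x + a) _) (_ , Equivalence.from (shift-a x _) (w , w∈ , refl) , refl))

  YShift-* : ∀ {p} → YShift Y p → ∀ k → YShift Y (k * p)
  YShift-* shift zero    = YShift-zero
  YShift-* shift (suc k) = YShift-+ shift (YShift-* shift k)

  YShift⇒+∈⇔ : ∀ {N} → YShift Y N → ∀ y v → + v ∈ Y y ⇔ + (v + N) ∈ Y (y + N)
  YShift⇒+∈⇔ {N} shift y v = mk⇔ up down
    where
    up : + v ∈ Y y → + (v + N) ∈ Y (y + N)
    up v∈ = subst (_∈ Y (y + N)) (sym (ℤP.pos-+ v N)) (Equivalence.from (shift y _) (+ v , v∈ , refl))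
    down : + (v + N) ∈ Y (y + N) → + v ∈ Y y
    down v+N∈ with Equivalence.to (shift y _) v+N∈
    ... | w , w∈ , eq = subst (_∈ Y y) (∙-cancelʳ (+ N) w (+ v) (trans (sym eq) (ℤP.pos-+ v N))) w∈

  -- Write y = r + k p with r < p: then + v ∈ Y y means + v = w + k p for some w ∈ Y r,
  -- and ∣ w ∣ is bounded uniformly in r, so k is bounded in terms of v.
  YShift⇒small-∉ : ∀ {p} → 1 ≤ p → YShift Y p → ∀ c →
                   ∃ λ B → ∀ {y v} → B ≤ y → v ≤ c → + v ∉ Y y
  YShift⇒small-∉ {p} 1≤p shift c = suc (c + b) * p , small-∉
    where
    instance
      p-nonZero : NonZero p
      p-nonZero = >-nonZero 1≤p
    bound = bounded-below (λ r → proj₁ (∣∣-bounded (Y r))) p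
    b = proj₁ bound
    ∣∣≤b : ∀ {r w} → r < p → w ∈ Y r → ∣ w ∣ ≤ b
    ∣∣≤b {r} r<p w∈ = ≤-trans (proj₂ (∣∣-bounded (Y r)) w∈) (proj₂ bound r<p)
    small-∉ : ∀ {y v} → suc (c + b) * p ≤ y → v ≤ c → + v ∉ Y y
    small-∉ {y} {v} B≤y v≤c v∈
      with Equivalence.to (YShift-* shift (y / p) (y % p) (+ v))
                          (subst (λ y → + v ∈ Y y) (m≡m%n+[m/n]*n y p) v∈)
    ... | w , w∈ , eq = <⇒≱ y<B B≤y
      where
      k = y / p
      k≤c+b : k ≤ c + b
      k≤c+b = ≤-trans (m≤m*n k p) (≤-trans (+v≡w+m⇒m≤v+∣w∣ w eq)
                                           (+-mono-≤ v≤c (∣∣≤b (m%n<n y p) w∈)))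
      y<B : y < suc (c + b) * p
      y<B = begin-strict
        y             ≡⟨ m≡m%n+[m/n]*n y p ⟩
        y % p + k * p <⟨ +-monoˡ-< (k * p) (m%n<n y p) ⟩
        p + k * p     ≤⟨ +-monoʳ-≤ p (*-monoˡ-≤ p k≤c+b) ⟩
        suc (c + b) * p ∎
        where open ≤-Reasoning

IsMex-shift : ∀ {S S' : ℤ → Set} {m m' x N} → IsMex S m → IsMex S' m' → x < m → x + N < m' →
              (∀ {v} → x < v → S (+ v) ⇔ S' (+ (v + N))) → m' ≡ m + N
IsMex-shift {m = m} {m'} {x} {N} (m∉S , S-below) (m'∉S' , S'-below) x<m x+N<m' S≃S'
  with <-cmp m' (m + N)
... | tri≈ _ m'≡m+N _ = m'≡m+N
... | tri> _ _ m+N<m' = ⊥-elim (m∉S (Equivalence.from (S≃S' x<m) (S'-below (m + N) m+N<m')))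
... | tri< m'<m+N _ _ with ≤-+-split N x+N<m'
...   | u , x<u , refl =
        ⊥-elim (m'∉S' (Equivalence.to (S≃S' x<u) (S-below u (+-cancelʳ-< N u m m'<m+N))))

CutShift : (ℕ → ℕ) → ℕ → ℕ → Set
CutShift G N x = (T G (x + N) ≐ T G x +ˢ N) × (T* G (x + N) ≐ T* G x +ˢ N)

module _ {G : ℕ → ℕ} {P N x : ℕ} (shift : ShiftsFrom G P N) (P≤x : P ≤ x)
         (bounded : ∀ {y} → y < P + N → G y ≤ x) where

  T-shifted : T G (x + N) ≐ T G x +ˢ N
  T-shifted _ = mk⇔ down up
    where
    down : ∀ {y} → T G (x + N) y → ∃ λ y' → T G x y' × y ≡ y' + N
    down (x+N<y , Gy≤x+N) with ≤-+-split N x+N<y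
    ... | y' , x<y' , refl =
      y' , (x<y' , +-cancelʳ-≤ N _ _ (subst (_≤ x + N) G[y'+N]≡ Gy≤x+N)) , refl
      where
      G[y'+N]≡ : G (y' + N) ≡ G y' + N
      G[y'+N]≡ = shift y' (≤-trans P≤x (<⇒≤ x<y'))
    up : ∀ {y} → (∃ λ y' → T G x y' × y ≡ y' + N) → T G (x + N) y
    up (y' , (x<y' , Gy'≤x) , refl) =
      +-monoˡ-< N x<y' ,
      subst (_≤ x + N) (sym (shift y' (≤-trans P≤x (<⇒≤ x<y')))) (+-monoˡ-≤ N Gy'≤x)

  T*-shifted : T* G (x + N) ≐ T* G x +ˢ N
  T*-shifted _ = mk⇔ down up
    where
    down : ∀ {v} → T* G (x + N) v → ∃ λ v' → T* G x v' × v ≡ v' + N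
    down (y , (y≤x+N , x+N<Gy) , refl) with ≤-+-split N (≮⇒≥ λ y<P+N →
                                             <⇒≱ x+N<Gy (≤-trans (bounded y<P+N) (m≤m+n x N)))
    ... | y' , P≤y' , refl rewrite shift y' P≤y' =
      G y' , (y' , (+-cancelʳ-≤ N y' x y≤x+N , +-cancelʳ-< N x (G y') x+N<Gy) , refl) , refl
    up : ∀ {v} → (∃ λ v' → T* G x v' × v ≡ v' + N) → T* G (x + N) v
    up (_ , (y , (y≤x , x<Gy) , refl) , refl) = y + N , (+-monoˡ-≤ N y≤x , x+N<G[y+N]) , Gy+N
      where
      Gy+N : G (y + N) ≡ G y + N
      Gy+N = shift y (≮⇒≥ λ y<P → <⇒≱ x<Gy (bounded (<-≤-trans y<P (m≤m+n P N))))
      x+N<G[y+N] : x + N < G (y + N)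
      x+N<G[y+N] = subst (x + N <_) (sym Gy+N) (+-monoˡ-< N x<Gy)

GShift⇒CutShift : ∀ {G N} L → GShift G N → ∃ λ x → L ≤ x × CutShift G N x
GShift⇒CutShift {G} {N} L (P , shift) =
  x , m≤m+n L _ , T-shifted shift P≤x bounded , T*-shifted shift P≤x bounded
  where
  bound = bounded-below G (P + N)
  b = proj₁ bound
  x = L + (P + b)
  P≤x : P ≤ x
  P≤x = ≤-trans (m≤m+n P b) (m≤n+m _ L)
  bounded : ∀ {y} → y < P + N → G y ≤ x
  bounded y<P+N = ≤-trans (proj₂ bound y<P+N) (≤-trans (m≤n+m b P) (m≤n+m _ L))

module NimSequence {Y : FinSubsetSeq} {seed : List ℕ} {G : ℕ → ℕ} (nim : IsNimSeq Y seed G) where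

  L : ℕ
  L = length seed

  mex : ∀ {y} → L ≤ y → IsMex (MexSet Y G y) (G y)
  mex L≤y = proj₂ (proj₂ nim) _ L≤y

  G-distinct : ∀ {a b} → a < b → L ≤ b → G a ≢ G b
  G-distinct a<b L≤b eq = proj₁ (mex L≤b) (inj₁ (_ , a<b , cong +_ eq))

  -- If G y ≤ x for a late y, the x + 1 distinct values G (M + i), i ≤ x, all lie below G y:
  -- G y is neither an earlier value nor (M being large) an element of Y (M + i).
  G-eventually-> : ∀ {p} → 1 ≤ p → YShift Y p → ∀ x → ∃ λ P → ∀ {y} → P ≤ y → x < G y
  G-eventually-> {p} 1≤p shift x = M + suc x , G>x
    where
    B = proj₁ (YShift⇒small-∉ 1≤p shift x)
    M = L + B
    G>x : ∀ {y} → M + suc x ≤ y → x < G y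
    G>x {y} M+1+x≤y = ≰⇒> λ Gy≤x →
      collision-free (pigeonhole x (λ i → G (M + i)) (λ i≤x → <-≤-trans (earlier<Gy Gy≤x i≤x) Gy≤x))
      where
      M+i<y : ∀ {i} → i ≤ x → M + i < y
      M+i<y i≤x = <-≤-trans (+-monoʳ-< M (s≤s i≤x)) M+1+x≤y
      L≤M+i : ∀ i → L ≤ M + i
      L≤M+i i = ≤-trans (m≤m+n L B) (m≤m+n M i)
      L≤y : L ≤ y
      L≤y = <⇒≤ (≤-<-trans (L≤M+i 0) (M+i<y z≤n))
      earlier<Gy : G y ≤ x → ∀ {i} → i ≤ x → G (M + i) < G y
      earlier<Gy Gy≤x {i} i≤x =
        ≤∧≢⇒< (≮⇒≥ λ Gy<G[M+i] → Gy∉ (proj₂ (mex (L≤M+i i)) (G y) Gy<G[M+i]))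
              (G-distinct (M+i<y i≤x) L≤y)
        where
        Gy∉ : ¬ MexSet Y G (M + i) (+ G y)
        Gy∉ (inj₁ (y' , y'<M+i , eq)) = G-distinct (<-trans y'<M+i (M+i<y i≤x)) L≤y (ℤP.+-injective eq)
        Gy∉ (inj₂ Gy∈Y) =
          proj₂ (YShift⇒small-∉ 1≤p shift x) (≤-trans (m≤n+m B L) (m≤m+n M i)) Gy≤x Gy∈Y
      collision-free : ¬ ∃₂ λ i j → i < j × j ≤ x × G (M + i) ≡ G (M + j)
      collision-free (i , j , i<j , _ , eq) = G-distinct (+-monoʳ-< M i<j) (L≤M+i j) eq

  module _ {N x : ℕ} (shift-Y : YShift Y N) (L≤x : L ≤ x) (cut : CutShift G N x) where

    >x⇒>x+N : ∀ {y} → x < y → x < G y → x + N < G (y + N)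
    >x⇒>x+N {y} x<y x<Gy = ≰⇒> λ G[y+N]≤x+N →
      let y' , (_ , Gy'≤x) , eq = Equivalence.to (proj₁ cut (y + N)) (+-monoˡ-< N x<y , G[y+N]≤x+N)
      in <⇒≱ x<Gy (subst (λ z → G z ≤ x) (sym (+-cancelʳ-≡ N y y' eq)) Gy'≤x)

    >x+N⇒>x : ∀ {y} → x < y → x + N < G (y + N) → x < G y
    >x+N⇒>x x<y x+N<G[y+N] = ≰⇒> λ Gy≤x →
      <⇒≱ x+N<G[y+N] (proj₂ (Equivalence.from (proj₁ cut _) (_ , (x<y , Gy≤x) , refl)))

    T*-up : ∀ {v} → T* G x v → T* G (x + N) (v + N)
    T*-up t = Equivalence.from (proj₂ cut _) (_ , t , refl)

    T*-down : ∀ {v} → T* G (x + N) (v + N) → T* G x v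
    T*-down {v} t with Equivalence.to (proj₂ cut (v + N)) t
    ... | v' , t' , eq = subst (T* G x) (sym (+-cancelʳ-≡ N v v' eq)) t'

    ShiftsAbove : ℕ → Set
    ShiftsAbove y = x < y → x < G y → G (y + N) ≡ G y + N

    MexSet-up : ∀ {y v} → (∀ {y'} → y' < y → ShiftsAbove y') → x < y → x < v →
                MexSet Y G y (+ v) → MexSet Y G (y + N) (+ (v + N))
    MexSet-up {y} {v} _ _ _ (inj₂ v∈Y) = inj₂ (Equivalence.to (YShift⇒+∈⇔ shift-Y y v) v∈Y)
    MexSet-up ih x<y x<v (inj₁ (y' , y'<y , eq)) with ℤP.+-injective eq | y' ≤? x
    ... | refl | yes y'≤x =
      let y'' , (y''≤x+N , _) , eq'' = T*-up (y' , (y'≤x , x<v) , refl)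
      in inj₁ (y'' , ≤-<-trans y''≤x+N (+-monoˡ-< N x<y) , cong +_ eq'')
    ... | refl | no y'≰x = inj₁ (y' + N , +-monoˡ-< N y'<y , cong +_ (ih y'<y (≰⇒> y'≰x) x<v))

    MexSet-down : ∀ {y v} → (∀ {y'} → y' < y → ShiftsAbove y') → x < y → x < v →
                  MexSet Y G (y + N) (+ (v + N)) → MexSet Y G y (+ v)
    MexSet-down {y} {v} _ _ _ (inj₂ v+N∈Y) = inj₂ (Equivalence.from (YShift⇒+∈⇔ shift-Y y v) v+N∈Y)
    MexSet-down {y} {v} ih x<y x<v (inj₁ (y' , y'<y+N , eq)) with ℤP.+-injective eq | y' ≤? x + N
    ... | Gy'≡v+N | yes y'≤x+N =
      let x+N<Gy' = subst (x + N <_) (sym Gy'≡v+N) (+-monoˡ-< N x<v)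
          y'' , (y''≤x , _) , eq'' = T*-down (y' , (y'≤x+N , x+N<Gy') , Gy'≡v+N)
      in inj₁ (y'' , ≤-<-trans y''≤x x<y , cong +_ eq'')
    ... | Gy'≡v+N | no y'≰x+N with ≤-+-split N (≰⇒> y'≰x+N)
    ...   | y'' , x<y'' , refl = inj₁ (y'' , y''<y , cong +_ (+-cancelʳ-≡ N _ _ Gy''+N≡v+N))
      where
      y''<y : y'' < y
      y''<y = +-cancelʳ-< N y'' y y'<y+N
      x<Gy'' : x < G y''
      x<Gy'' = >x+N⇒>x x<y'' (subst (x + N <_) (sym Gy'≡v+N) (+-monoˡ-< N x<v))
      Gy''+N≡v+N : G y'' + N ≡ v + N
      Gy''+N≡v+N = trans (sym (ih y''<y x<y'' x<Gy'')) Gy'≡v+N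

    shifts-above : ∀ y → ShiftsAbove y
    shifts-above = <-rec ShiftsAbove λ y ih x<y x<Gy →
      IsMex-shift {S = MexSet Y G y} {S' = MexSet Y G (y + N)}
                  (mex (L≤ x<y)) (mex (≤-trans (L≤ x<y) (m≤m+n y N))) x<Gy (>x⇒>x+N x<y x<Gy)
                  (λ x<v → mk⇔ (MexSet-up ih x<y x<v) (MexSet-down ih x<y x<v))
      where
      L≤ : ∀ {y} → x < y → L ≤ y
      L≤ x<y = ≤-trans L≤x (<⇒≤ x<y)

    CutShift⇒GShift : ∀ {p} → 1 ≤ p → YShift Y p → GShift G N
    CutShift⇒GShift 1≤p shift-p with G-eventually-> 1≤p shift-p x
    ... | P , G>x = suc x + P , λ y suc[x+P]≤y →
      shifts-above y (≤-trans (m≤m+n (suc x) P) suc[x+P]≤y)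
                     (G>x (≤-trans (m≤n+m P (suc x)) suc[x+P]≤y))

lemmal : (Y : FinSubsetSeq) (p : ℕ) (seed : List ℕ) (G : ℕ → ℕ) (R : ℕ)
         → YPeriodLength Y p → IsNimSeq Y seed G → 1 ≤ R
         → (∃ λ q → GPeriodLength G q × q ∣ R * p)
           ⇔ (∃ λ x → x ≥ length seed
                × (T G (x + R * p) ≐ T G x +ˢ (R * p))
                × (T* G (x + R * p) ≐ T* G x +ˢ (R * p)))
lemmal Y p seed G R (1≤p , shift-p , _) nim 1≤R = mk⇔ periodic⇒cut cut⇒periodic
  where
  open NimSequence nim
  N = R * p
  periodic⇒cut : (∃ λ q → GPeriodLength G q × q ∣ N) → ∃ λ x → L ≤ x × CutShift G N x
  periodic⇒cut (q , (_ , shift-q , _) , divides k N≡kq) =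
    GShift⇒CutShift L (subst (GShift G) (sym N≡kq) (GShift-* shift-q k))
  cut⇒periodic : (∃ λ x → L ≤ x × CutShift G N x) → ∃ λ q → GPeriodLength G q × q ∣ N
  cut⇒periodic (x , L≤x , cut) =
    let shift-N = CutShift⇒GShift (YShift-* shift-p R) L≤x cut 1≤p shift-p
        q , period = GShift⇒GPeriodLength (*-mono-≤ 1≤R 1≤p) shift-N
    in q , period , GPeriodLength∣GShift period shift-N
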